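{- In each of the logics DmBL and DmBL$_\ast$, for all $\phi,\psi\in\mathcal{L}$: $\vdash(\psi\times\phi)\rightarrow\bigl(\Box(\phi\vee\psi)\rightarrow(\Box\phi\vee\Box\psi)\bigr)$.
   Context: Fix a set $\Theta$ of atomic propositions. The language $\mathcal{L}$ is the smallest set containing $\Theta$ and closed under the formation of $\neg\phi$, $\Box\phi$, $\phi\rightarrow\psi$ and the conditional $(\psi|\phi)$. Abbreviations: $\phi\vee\psi=\neg\phi\rightarrow\psi$, $\phi\wedge\psi=\neg(\neg\phi\vee\neg\psi)$, $\phi\leftrightarrow\psi=(\phi\rightarrow\psi)\wedge(\psi\rightarrow\phi)$, $\top=\theta_0\rightarrow\theta_0$ for a fixed $\theta_0\in\Theta$, $\bot=\neg\top$, $\Diamond\phi=\neg\Box\neg\phi$, and (logical independence) $\psi\times\phi=\Box\bigl((\psi|\phi)\leftrightarrow\psi\bigr)$. The theorems ($\vdash$) of DmBL are the smallest set containing all instances of the axiom schemes below and closed under modus ponens (from $\vdash\phi$ and $\vdash\phi\rightarrow\psi$ infer $\vdash\psi$) and necessitation m1 (from $\vdash\phi$ infer $\vdash\Box\phi$): c1 $\phi\rightarrow(\psi\rightarrow\phi)$; c2 $(\eta\rightarrow(\phi\rightarrow\psi))\rightarrow((\eta\rightarrow\phi)\rightarrow(\eta\rightarrow\psi))$; c3 $(\neg\phi\rightarrow\neg\psi)\rightarrow((\neg\phi\rightarrow\psi)\rightarrow\phi)$; m2 $\Box(\phi\rightarrow\psi)\rightarrow(\Box\phi\rightarrow\Box\psi)$;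 m3 $\Box\phi\rightarrow\phi$; b1 $\Box(\phi\rightarrow\psi)\rightarrow(\Box\neg\phi\vee\Box(\psi|\phi))$; b2 $((\psi\rightarrow\eta)|\phi)\rightarrow((\psi|\phi)\rightarrow(\eta|\phi))$; b3 $(\psi|\phi)\rightarrow(\phi\rightarrow\psi)$; b4 $\neg(\neg\psi|\phi)\leftrightarrow(\psi|\phi)$; b5 $(\psi\times\phi)\leftrightarrow(\phi\times\psi)$. The logic DmBL$_\ast$ is defined in the same way but with b5 replaced by the two schemes b5.weak.A $(\psi\times\neg\phi)\leftrightarrow(\psi\times\phi)$ and b5.weak.B $\Box(\psi\leftrightarrow\eta)\rightarrow\Box((\phi|\psi)\leftrightarrow(\phi|\eta))$. -}

module Defs where

open import Data.Product using (_×_)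

data Form (Θ : Set) : Set where
  atom : Θ → Form Θ
  ¬'_  : Form Θ → Form Θ
  □_   : Form Θ → Form Θ
  _⇒_  : Form Θ → Form Θ → Form Θ
  _∣_  : Form Θ → Form Θ → Form Θ   -- (ψ ∣ φ) is the conditional (ψ|φ)

infixr 6 _⇒_

module _ {Θ : Set} where
  infixr 7 _∨'_ _∧'_
  infix 5 _⇔_

  _∨'_ : Form Θ → Form Θ → Form Θ
  φ ∨' ψ = (¬' φ) ⇒ ψ

  _∧'_ : Form Θ → Form Θ → Form Θ
  φ ∧' ψ = ¬' ((¬' φ) ∨' (¬' ψ))

  _⇔_ : Form Θ → Form Θ → Form Θ
  φ ⇔ ψ = (φ ⇒ ψ) ∧' (ψ ⇒ φ)

  ◇_ : Form Θ → Form Θ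
  ◇ φ = ¬' (□ (¬' φ))

  -- logical independence ψ × φ = □((ψ|φ) ↔ ψ)
  _⊗_ : Form Θ → Form Θ → Form Θ
  ψ ⊗ φ = □ ((ψ ∣ φ) ⇔ ψ)

⊤' : {Θ : Set} → Θ → Form Θ
⊤' θ₀ = atom θ₀ ⇒ atom θ₀

⊥' : {Θ : Set} → Θ → Form Θ
⊥' θ₀ = ¬' (⊤' θ₀)

data Logic : Set where
  DmBL DmBL* : Logic

infix 4 _⊢_
data _⊢_ {Θ : Set} : Logic → Form Θ → Set where
  c1 : ∀ {L} φ ψ → L ⊢ (φ ⇒ (ψ ⇒ φ))
  c2 : ∀ {L} η φ ψ → L ⊢ ((η ⇒ (φ ⇒ ψ)) ⇒ ((η ⇒ φ) ⇒ (η ⇒ ψ)))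
  c3 : ∀ {L} φ ψ → L ⊢ (((¬' φ) ⇒ (¬' ψ)) ⇒ (((¬' φ) ⇒ ψ) ⇒ φ))
  m2 : ∀ {L} φ ψ → L ⊢ (□ (φ ⇒ ψ) ⇒ (□ φ ⇒ □ ψ))
  m3 : ∀ {L} φ → L ⊢ (□ φ ⇒ φ)
  b1 : ∀ {L} φ ψ → L ⊢ (□ (φ ⇒ ψ) ⇒ ((□ (¬' φ)) ∨' (□ (ψ ∣ φ))))
  b2 : ∀ {L} φ ψ η → L ⊢ (((ψ ⇒ η) ∣ φ) ⇒ ((ψ ∣ φ) ⇒ (η ∣ φ)))
  b3 : ∀ {L} φ ψ → L ⊢ ((ψ ∣ φ) ⇒ (φ ⇒ ψ))
  b4 : ∀ {L} φ ψ → L ⊢ ((¬' ((¬' ψ) ∣ φ)) ⇔ (ψ ∣ φ))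
  b5 : ∀ φ ψ → DmBL ⊢ ((ψ ⊗ φ) ⇔ (φ ⊗ ψ))
  b5wA : ∀ φ ψ → DmBL* ⊢ ((ψ ⊗ (¬' φ)) ⇔ (ψ ⊗ φ))
  b5wB : ∀ φ ψ η → DmBL* ⊢ (□ (ψ ⇔ η) ⇒ □ ((φ ∣ ψ) ⇔ (φ ∣ η)))
  mp : ∀ {L φ ψ} → L ⊢ φ → L ⊢ (φ ⇒ ψ) → L ⊢ ψ
  nec : ∀ {L φ} → L ⊢ φ → L ⊢ (□ φ)

{-# OPTIONS --safe #-}
module Submission where

-- If ψ ⊗ ¬φ, i.e. □((ψ|¬φ) ↔ ψ), then from □(¬φ → ψ) and ¬□φ = ◇¬φ axiom b1
-- gives □(ψ|¬φ), hence □ψ. So it suffices that independence from φ entails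
-- independence from ¬φ. In DmBL* this is b5.weak.A. In DmBL, by b5 it amounts
-- to φ ⊗ ψ ⇒ ¬φ ⊗ ψ, which holds because by b4 the conditional (¬φ|ψ) is
-- equivalent to ¬(φ|ψ).

open import Data.List using (List; []; _∷_)
open import Data.List.Membership.Propositional using (_∈_)
open import Data.List.Relation.Unary.Any using (here; there)
open import Relation.Binary.PropositionalEquality using (refl)

open import Defs

module HilbertCalculus {Θ : Set} (L : Logic) where

  infix  4 _⊩_
  infixl 5 _·_

  data _⊩_ (Γ : List (Form Θ)) : Form Θ → Set where
    assumption : ∀ {φ} → φ ∈ Γ → Γ ⊩ φ
    theorem    : ∀ {φ} → L ⊢ φ → Γ ⊩ φ
    _·_        : ∀ {φ ψ} → Γ ⊩ (φ ⇒ ψ) → Γ ⊩ φ → Γ ⊩ ψ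

  #0 : ∀ {Γ A} → A ∷ Γ ⊩ A
  #0 = assumption (here refl)

  #1 : ∀ {Γ A B} → B ∷ A ∷ Γ ⊩ A
  #1 = assumption (there (here refl))

  #2 : ∀ {Γ A B C} → C ∷ B ∷ A ∷ Γ ⊩ A
  #2 = assumption (there (there (here refl)))

  #3 : ∀ {Γ A B C E} → E ∷ C ∷ B ∷ A ∷ Γ ⊩ A
  #3 = assumption (there (there (there (here refl))))

  discharge : ∀ {φ} → [] ⊩ φ → L ⊢ φ
  discharge (theorem t) = t
  discharge (d · e)     = mp (discharge e) (discharge d)

  ⇒-refl : (A : Form Θ) → L ⊢ (A ⇒ A)
  ⇒-refl A = mp (c1 A A) (mp (c1 A (A ⇒ A)) (c2 A (A ⇒ A) A))

  deduction : ∀ {Γ A B} → A ∷ Γ ⊩ B → Γ ⊩ (A ⇒ B)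
  deduction {A = A}     (assumption (here refl)) = theorem (⇒-refl A)
  deduction {A = A} {B} (assumption (there p))   = theorem (c1 B A) · assumption p
  deduction {A = A}     (theorem {φ} t)          = theorem (c1 φ A) · theorem t
  deduction {A = A}     (_·_ {φ} {ψ} d e)        = theorem (c2 A φ ψ) · deduction d · deduction e

  ⇒-trans : {A B C : Form Θ} → L ⊢ (A ⇒ B) → L ⊢ (B ⇒ C) → L ⊢ (A ⇒ C)
  ⇒-trans t u = discharge (deduction (theorem u · (theorem t · #0)))

  ¬¬-elim : (A : Form Θ) → L ⊢ (¬' ¬' A ⇒ A)
  ¬¬-elim A = discharge (deduction (theorem (c3 A (¬' A)) · deduction #1 · theorem (⇒-refl (¬' A))))

  ¬¬-intro : (A : Form Θ) → L ⊢ (A ⇒ ¬' ¬' A)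
  ¬¬-intro A = discharge (deduction (theorem (c3 (¬' ¬' A) A) · theorem (¬¬-elim (¬' A)) · deduction #1))

  explosion : (A B : Form Θ) → L ⊢ (A ⇒ (¬' A ⇒ B))
  explosion A B = discharge (deduction (deduction (theorem (c3 B A) · deduction #1 · deduction #2)))

  contraposition⁻¹ : (A B : Form Θ) → L ⊢ ((¬' B ⇒ ¬' A) ⇒ (A ⇒ B))
  contraposition⁻¹ A B = discharge (deduction (deduction (theorem (c3 B A) · #1 · deduction #1)))

  contraposition : (A B : Form Θ) → L ⊢ ((A ⇒ B) ⇒ (¬' B ⇒ ¬' A))
  contraposition A B = discharge (deduction
    (theorem (contraposition⁻¹ (¬' B) (¬' A))
      · deduction (theorem (¬¬-intro B) · (#1 · (theorem (¬¬-elim A) · #0)))))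

  ∧-elimˡ : (A B : Form Θ) → L ⊢ ((A ∧' B) ⇒ A)
  ∧-elimˡ A B = discharge (deduction (theorem (¬¬-elim A)
    · (theorem (contraposition (¬' A) (¬' ¬' A ⇒ ¬' B)) · theorem (explosion (¬' A) (¬' B)) · #0)))

  ∧-elimʳ : (A B : Form Θ) → L ⊢ ((A ∧' B) ⇒ B)
  ∧-elimʳ A B = discharge (deduction (theorem (¬¬-elim B)
    · (theorem (contraposition (¬' B) (¬' ¬' A ⇒ ¬' B)) · theorem (c1 (¬' B) (¬' ¬' A)) · #0)))

  ∧-intro : (A B : Form Θ) → L ⊢ (A ⇒ (B ⇒ (A ∧' B)))
  ∧-intro A B = discharge (deduction (deduction
    (theorem (contraposition (¬' ¬' A ⇒ ¬' B) (¬' B))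
      · deduction (#0 · (theorem (¬¬-intro A) · #2))
      · (theorem (¬¬-intro B) · #0))))

  ⇔-elimˡ : (A B : Form Θ) → L ⊢ ((A ⇔ B) ⇒ (A ⇒ B))
  ⇔-elimˡ A B = ∧-elimˡ (A ⇒ B) (B ⇒ A)

  ⇔-elimʳ : (A B : Form Θ) → L ⊢ ((A ⇔ B) ⇒ (B ⇒ A))
  ⇔-elimʳ A B = ∧-elimʳ (A ⇒ B) (B ⇒ A)

  ⇔-intro : (A B : Form Θ) → L ⊢ ((A ⇒ B) ⇒ ((B ⇒ A) ⇒ (A ⇔ B)))
  ⇔-intro A B = ∧-intro (A ⇒ B) (B ⇒ A)

  ¬⇔-trans : (A B C : Form Θ) → L ⊢ ((¬' A ⇔ B) ⇒ ((B ⇔ C) ⇒ (A ⇔ ¬' C)))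
  ¬⇔-trans A B C = discharge (deduction (deduction (theorem (⇔-intro A (¬' C)) · forth · back)))
    where
      forth : (B ⇔ C) ∷ (¬' A ⇔ B) ∷ [] ⊩ (A ⇒ ¬' C)
      forth = deduction (theorem (contraposition C (¬' A))
        · deduction (theorem (⇔-elimʳ (¬' A) B) · #3 · (theorem (⇔-elimʳ B C) · #2 · #0))
        · (theorem (¬¬-intro A) · #0))
      back : (B ⇔ C) ∷ (¬' A ⇔ B) ∷ [] ⊩ (¬' C ⇒ A)
      back = deduction (theorem (¬¬-elim A)
        · (theorem (contraposition (¬' A) B) · (theorem (⇔-elimˡ (¬' A) B) · #2)
          · (theorem (contraposition B C) · (theorem (⇔-elimˡ B C) · #1) · #0)))

  □-mono : {A B : Form Θ} → L ⊢ (A ⇒ B) → L ⊢ (□ A ⇒ □ B)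
  □-mono {A} {B} t = mp (nec t) (m2 A B)

  ⊗-¬ˡ : (φ ψ : Form Θ) → L ⊢ ((φ ⊗ ψ) ⇒ ((¬' φ) ⊗ ψ))
  ⊗-¬ˡ φ ψ = □-mono (mp (b4 ψ φ) (¬⇔-trans ((¬' φ) ∣ ψ) (φ ∣ ψ) φ))

  ⊗¬⇒□-distrib-∨ : (φ ψ : Form Θ) → L ⊢ ((ψ ⊗ (¬' φ)) ⇒ (□ (φ ∨' ψ) ⇒ ((□ φ) ∨' (□ ψ))))
  ⊗¬⇒□-distrib-∨ φ ψ = discharge (deduction (deduction (deduction
    (theorem (m2 (ψ ∣ (¬' φ)) ψ) · (theorem (□-mono (⇔-elimˡ (ψ ∣ (¬' φ)) ψ)) · #2)
      · (theorem (b1 (¬' φ) ψ) · #1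
          · (theorem (contraposition (□ (¬' ¬' φ)) (□ φ)) · theorem (□-mono (¬¬-elim φ)) · #0))))))

open HilbertCalculus

⊗-sym : {Θ : Set} (φ ψ : Form Θ) → DmBL ⊢ ((ψ ⊗ φ) ⇒ (φ ⊗ ψ))
⊗-sym φ ψ = mp (b5 φ ψ) (⇔-elimˡ DmBL _ _)

⊗-¬ʳ : {Θ : Set} (L : Logic) (φ ψ : Form Θ) → L ⊢ ((ψ ⊗ φ) ⇒ (ψ ⊗ (¬' φ)))
⊗-¬ʳ DmBL  φ ψ = ⇒-trans DmBL (⊗-sym φ ψ) (⇒-trans DmBL (⊗-¬ˡ DmBL φ ψ) (⊗-sym ψ (¬' φ)))
⊗-¬ʳ DmBL* φ ψ = mp (b5wA φ ψ) (⇔-elimʳ DmBL* _ _)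

mainTheorem9 : {Θ : Set} (L : Logic) (φ ψ : Form Θ) →
    L ⊢ ((ψ ⊗ φ) ⇒ (□ (φ ∨' ψ) ⇒ ((□ φ) ∨' (□ ψ))))
mainTheorem9 L φ ψ = ⇒-trans L (⊗-¬ʳ L φ ψ) (⊗¬⇒□-distrib-∨ L φ ψ)
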